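{- Let $T$ be a tree with color classes $A$ and $B$ such that $|A|\le|B|$ and $\delta(A)=\min_{x\in A}d_T(x)\ge 2$. Then: (i) $\beta(T)=|A|$; (ii) $\min\{\beta(T'):T'\in\mathcal{H}(T)\}\ge |A|$; (iii) for every $m\ge1$, the graph $K_{|A|-1}\vee K_m^c$ contains no member of $\mathcal{H}(T)$ as a subgraph.
   Context: $\beta(G)$ is the vertex covering number of $G$. $K_m^c$ is the edgeless graph on $m$ vertices and $\vee$ denotes the join. A vertex split on a vertex $v$ replaces $v$ by an independent set of $d(v)$ new vertices, each adjacent to exactly one distinct vertex of $N(v)$; the splitting family $\mathcal{H}(T)$ consists of all graphs obtained from $T$ by applying vertex splits to the vertices of some subset $U\subseteq V(T)$ one by one (including $U=\emptyset$). -}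

module Defs where

open import Data.Bool using (Bool; true; false; not; T)
open import Data.Bool.Properties using (T-irrelevant)
open import Data.Nat using (ℕ; _≤_)
open import Data.Fin using (Fin)
import Data.Fin.Properties as FinP
open import Data.Fin.Subset using (Subset; ∣_∣)
open import Data.Vec using (tabulate)
open import Data.List using (List; []; _∷_; length; _∷ʳ_)
open import Data.List.Membership.Propositional using (_∈_)
open import Data.List.Relation.Unary.Unique.Propositional using (Unique)
open import Data.List.Relation.Unary.Linked using (Linked)
open import Data.Product using (Σ; _,_; _×_; ∃; proj₁)
open import Data.Sum using (_⊎_; inj₁; inj₂)
open import Data.Sum.Properties using (≡-dec)
open import Data.Maybe using (Maybe; just; nothing)
open import Relation.Nullary using (¬_; yes; no)
open import Relation.Nullary.Decidable using (⌊_⌋)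
open import Relation.Binary.Definitions using (DecidableEquality)
open import Relation.Binary.PropositionalEquality using (_≡_; refl; sym; _≢_)
open import Relation.Binary.Construct.Closure.ReflexiveTransitive using (Star)
open import Function using (_∘_)
import Data.Empty
open import Function.Definitions using (Injective)

-- Finite simple graphs with an arbitrary vertex type (needed so that a
-- vertex split can be expressed literally).  Adjacency is Bool-valued.

record Graph : Set₁ where
  field
    V      : Set
    _≟_    : DecidableEquality V
    adj    : V → V → Bool
    adj-sym    : ∀ x y → adj x y ≡ adj y x
    adj-irrefl : ∀ x → adj x x ≡ false

open Graph public

Edge : (G : Graph) → V G → V G → Set
Edge G x y = T (adj G x y)

finGraph : (n : ℕ) (a : Fin n → Fin n → Bool) →
           (∀ x y → a x y ≡ a y x) → (∀ x → a x x ≡ false) → Graph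
finGraph n a s i = record
  { V = Fin n ; _≟_ = FinP._≟_ ; adj = a ; adj-sym = s ; adj-irrefl = i }

degree : {n : ℕ} → (Fin n → Fin n → Bool) → Fin n → ℕ
degree a x = ∣ tabulate (a x) ∣

Connected : Graph → Set
Connected G = ∀ x y → Star (Edge G) x y

IsCycle : (G : Graph) → V G → List (V G) → Set
IsCycle G x ys =
  (2 ≤ length ys) × Unique (x ∷ ys) × Linked (Edge G) ((x ∷ ys) ∷ʳ x)

Acyclic : Graph → Set
Acyclic G = ∀ x ys → ¬ IsCycle G x ys

IsTree : Graph → Set
IsTree G = Connected G × Acyclic G

IsVertexCover : (G : Graph) → List (V G) → Set
IsVertexCover G S = ∀ x y → Edge G x y → (x ∈ S) ⊎ (y ∈ S)

IsVertexCoverNumber : Graph → ℕ → Set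
IsVertexCoverNumber G k =
  (Σ (List (V G)) λ S → Unique S × IsVertexCover G S × length S ≡ k) ×
  (∀ S → Unique S → IsVertexCover G S → k ≤ length S)

private
  ΣT-≟ : {A : Set} → DecidableEquality A → (P : A → Bool) →
         DecidableEquality (Σ A (T ∘ P))
  ΣT-≟ _≟A_ P (x , p) (y , q) with x ≟A y
  ... | yes refl with T-irrelevant p q
  ... | refl = yes refl
  ΣT-≟ _≟A_ P (x , p) (y , q) | no x≢y = no λ { refl → x≢y refl }

  ⌊⌋-sym : {A : Set} (_≟A_ : DecidableEquality A) (x y : A) →
           ⌊ x ≟A y ⌋ ≡ ⌊ y ≟A x ⌋
  ⌊⌋-sym _≟A_ x y with x ≟A y | y ≟A x
  ... | yes _ | yes _ = refl
  ... | yes refl | no n = ⊥-elim' (n refl)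
    where ⊥-elim' : ∀ {B : Set} → Data.Empty.⊥ → B
          ⊥-elim' ()
  ... | no n | yes refl = ⊥-elim' (n refl)
    where ⊥-elim' : ∀ {B : Set} → Data.Empty.⊥ → B
          ⊥-elim' ()
  ... | no _ | no _ = refl

-- vertices of the split graph: old vertices other than v, and one new
-- vertex ⟨v,w⟩ for each neighbour w of v
SplitV : (G : Graph) → V G → Set
SplitV G v = (Σ (V G) λ x → T (not ⌊ _≟_ G x v ⌋)) ⊎ (Σ (V G) λ w → T (adj G v w))

splitAdj : (G : Graph) (v : V G) → SplitV G v → SplitV G v → Bool
splitAdj G v (inj₁ (x , _)) (inj₁ (y , _)) = adj G x y
splitAdj G v (inj₁ (x , _)) (inj₂ (w , _)) = ⌊ _≟_ G x w ⌋
splitAdj G v (inj₂ (w , _)) (inj₁ (x , _)) = ⌊ _≟_ G w x ⌋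
splitAdj G v (inj₂ _)       (inj₂ _)       = false

Split : (G : Graph) → V G → Graph
Split G v = record
  { V = SplitV G v
  ; _≟_ = ≡-dec (ΣT-≟ (_≟_ G) _) (ΣT-≟ (_≟_ G) _)
  ; adj = splitAdj G v
  ; adj-sym = s
  ; adj-irrefl = i
  }
  where
  s : ∀ a b → splitAdj G v a b ≡ splitAdj G v b a
  s (inj₁ (x , _)) (inj₁ (y , _)) = adj-sym G x y
  s (inj₁ (x , _)) (inj₂ (w , _)) = ⌊⌋-sym (_≟_ G) x w
  s (inj₂ (w , _)) (inj₁ (x , _)) = ⌊⌋-sym (_≟_ G) w x
  s (inj₂ _)       (inj₂ _)       = refl
  i : ∀ a → splitAdj G v a a ≡ false
  i (inj₁ (x , _)) = adj-irrefl G x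
  i (inj₂ _)       = refl

splitOrig : {A : Set} (G : Graph) (v : V G) → (V G → Maybe A) → SplitV G v → Maybe A
splitOrig G v o (inj₁ (x , _)) = o x
splitOrig G v o (inj₂ _)       = nothing

-- The splitting family H(T): graphs obtained from T by splitting the
-- vertices of a subset U ⊆ V(T) one by one.  The map o records, for each
-- vertex of the current graph, the original vertex of T it is (nothing for
-- vertices created by splits); only original, not yet split vertices may
-- be split, so each vertex of T is split at most once.

data InH (T₀ : Graph) : (G : Graph) → (V G → Maybe (V T₀)) → Set₁ where
  base : InH T₀ T₀ just
  step : ∀ {G o} → InH T₀ G o → (v : V G) → (Σ (V T₀) λ t → o v ≡ just t) →
         InH T₀ (Split G v) (splitOrig G v o)

_∈H_ : Graph → Graph → Set₁
G ∈H T₀ = Σ (V G → Maybe (V T₀)) λ o → InH T₀ G o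

private
  ⌊⌋-irr : ∀ {n} (i : Fin n) → not ⌊ i FinP.≟ i ⌋ ≡ false
  ⌊⌋-irr i with i FinP.≟ i
  ... | yes _ = refl
  ... | no n = ⊥-elim' (n refl)
    where ⊥-elim' : ∀ {B : Set} → Data.Empty.⊥ → B
          ⊥-elim' ()

joinAdj : (p m : ℕ) → Fin p ⊎ Fin m → Fin p ⊎ Fin m → Bool
joinAdj p m (inj₁ i) (inj₁ j) = not ⌊ i FinP.≟ j ⌋
joinAdj p m (inj₁ _) (inj₂ _) = true
joinAdj p m (inj₂ _) (inj₁ _) = true
joinAdj p m (inj₂ _) (inj₂ _) = false

KjoinKc : (p m : ℕ) → Graph
KjoinKc p m = record
  { V = Fin p ⊎ Fin m
  ; _≟_ = ≡-dec FinP._≟_ FinP._≟_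
  ; adj = joinAdj p m
  ; adj-sym = s
  ; adj-irrefl = i
  }
  where
  s : ∀ a b → joinAdj p m a b ≡ joinAdj p m b a
  s (inj₁ x) (inj₁ y) rewrite ⌊⌋-sym FinP._≟_ x y = refl
  s (inj₁ _) (inj₂ _) = refl
  s (inj₂ _) (inj₁ _) = refl
  s (inj₂ _) (inj₂ _) = refl
  i : ∀ a → joinAdj p m a a ≡ false
  i (inj₁ x) = ⌊⌋-irr x
  i (inj₂ _) = refl

_⊆G_ : Graph → Graph → Set
H ⊆G G = Σ (V H → V G) λ f → Injective _≡_ _≡_ f × (∀ x y → Edge H x y → Edge G (f x) (f y))

module Submission where

-- Root the tree T at any vertex.  Every x ∈ A has degree at least 2 but at
-- most one neighbour closer to the root (two would close a cycle) and no
-- neighbour at the same depth (the 2-colouring gives depth parity), so x has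
-- a child.  The edges from each x ∈ A to a chosen child form a matching of
-- size |A|, because distinct vertices have distinct children and a child lies
-- in B.  Splitting a vertex keeps, for every old edge, an edge of the new
-- graph projecting onto it, so every member of H(T) carries a matching of
-- size |A|; hence β ≥ |A| on H(T), with equality for T itself since A covers
-- T.  In K_{|A|-1} ∨ K_m^c the clique side is a vertex cover with |A| - 1
-- vertices, and a subgraph would inherit the matching of size |A|.

open import Defs
open import Data.Bool using (Bool; true; false; not; T)
open import Data.Bool.Properties using (¬-not; T-not-≡)
open import Data.Nat
  using (ℕ; zero; suc; _≤_; _<_; _≤′_; ≤′-refl; ≤′-step; _≰_; _∸_; z≤n; s≤s)
open import Data.Nat.Properties
  using ( ≤-reflexive; ≤-trans; ≤-antisym; <-irrefl; <-cmp; ≰⇒>; ≮⇒≥; ≤⇒≤′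
        ; m≤n⇒m≤1+n; m≤n+m; suc-injective)
import Data.Nat.Properties as ℕ
open import Data.Nat.GeneralisedArithmetic using (fold)
open import Data.Fin using (Fin; zero; suc)
import Data.Fin.Properties as FinP
open import Data.Fin.Subset using (∣_∣)
open import Data.Fin.Subset.Properties using (x∈p⇒∣p-x∣<∣p∣)
open import Data.Vec using (tabulate)
open import Data.Vec.Properties using (lookup⇒[]=; lookup∘tabulate)
open import Data.List using (List; []; _∷_; _∷ʳ_; length; map; filter; allFin)
import Data.List as List
open import Data.List.Properties using (length-map; length-tabulate; length-removeAt′; length-++)
open import Data.List.Membership.Propositional using (_∈_; _─_)
open import Data.List.Membership.Propositional.Properties
  using (∈-map⁺; ∈-map⁻; ∈-allFin; ∈-filter⁺)
open import Data.List.Relation.Unary.Any using (here; there)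
open import Data.List.Relation.Unary.All as All using (All; []; _∷_)
import Data.List.Relation.Unary.All.Properties as AllP
open import Data.List.Relation.Unary.AllPairs using ([]; _∷_)
open import Data.List.Relation.Unary.Unique.Propositional using (Unique)
import Data.List.Relation.Unary.Unique.Propositional.Properties as Unique
open import Data.List.Relation.Unary.Linked using (Linked; []; [-]; _∷_)
open import Data.Product using (Σ; _×_; _,_; proj₁; proj₂; ∃-syntax)
open import Data.Sum using (_⊎_; inj₁; inj₂)
open import Data.Unit using (tt)
open import Relation.Nullary using (¬_; yes; no; contradiction)
open import Relation.Nullary.Decidable using (T?; _×-dec_; _⊎-dec_; fromWitness; fromWitnessFalse)
open import Relation.Unary using (Decidable)
open import Relation.Binary.Definitions using (tri<; tri≈; tri>)
open import Relation.Binary.PropositionalEquality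
  using (_≡_; _≢_; refl; sym; trans; cong; subst; subst₂)
open import Relation.Binary.Construct.Closure.ReflexiveTransitive using (Star; ε; _◅_)
open import Function using (_∘_; Equivalence)

∈-─⁺ : ∀ {A : Set} {x y : A} {xs} (x∈xs : x ∈ xs) → y ∈ xs → y ≢ x → y ∈ xs ─ x∈xs
∈-─⁺ (here refl)  (here refl)  y≢x = contradiction refl y≢x
∈-─⁺ (here refl)  (there y∈xs) _   = y∈xs
∈-─⁺ (there x∈xs) (here refl)  _   = here refl
∈-─⁺ (there x∈xs) (there y∈xs) y≢x = there (∈-─⁺ x∈xs y∈xs y≢x)

∣tabulate∣≤length : ∀ {A : Set} {n} (P : Fin n → Bool) {xs : List A}
  (h : ∀ i → T (P i) → A) → (∀ i p → h i p ∈ xs) →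
  (∀ {i j p q} → h i p ≡ h j q → i ≡ j) → ∣ tabulate P ∣ ≤ length xs
∣tabulate∣≤length {n = zero} P h h∈xs h-inj = z≤n
∣tabulate∣≤length {n = suc n} P {xs} h h∈xs h-inj with P zero in P₀
... | false = ∣tabulate∣≤length (P ∘ suc) (h ∘ suc) (h∈xs ∘ suc) (FinP.suc-injective ∘ h-inj)
... | true = subst (suc ∣ tabulate (P ∘ suc) ∣ ≤_) (sym (length-removeAt′ xs _)) (s≤s rest)
  where
  p₀ : T (P zero)
  p₀ = subst T (sym P₀) _
  h₀∈xs : h zero p₀ ∈ xs
  h₀∈xs = h∈xs zero p₀
  rest : ∣ tabulate (P ∘ suc) ∣ ≤ length (xs ─ h₀∈xs)
  rest = ∣tabulate∣≤length (P ∘ suc) (h ∘ suc)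
    (λ i p → ∈-─⁺ h₀∈xs (h∈xs (suc i) p) (λ eq → FinP.0≢1+n (sym (h-inj eq))))
    (FinP.suc-injective ∘ h-inj)

1≤∣tabulate∣ : ∀ {n} (P : Fin n → Bool) i → P i ≡ true → 1 ≤ ∣ tabulate P ∣
1≤∣tabulate∣ P i Pi =
  ≤-trans (s≤s z≤n)
    (x∈p⇒∣p-x∣<∣p∣ (lookup⇒[]= i (tabulate P) (trans (lookup∘tabulate P i) Pi)))

length-filter-tabulate : ∀ {A : Set} {n} (Q : A → Bool) (f : Fin n → A) →
  length (filter (T? ∘ Q) (List.tabulate f)) ≡ ∣ tabulate (Q ∘ f) ∣
length-filter-tabulate {n = zero} Q f = refl
length-filter-tabulate {n = suc n} Q f with Q (f zero)
... | true  = cong suc (length-filter-tabulate Q (f ∘ suc))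
... | false = length-filter-tabulate Q (f ∘ suc)

least : ∀ {P : ℕ → Set} → Decidable P → (∀ {j k} → j ≤ k → P j → P k) →
  ∀ {k} → P k → ∃[ m ] P m × (∀ {j} → P j → m ≤ j)
least P? mono {zero} Pk = zero , Pk , λ _ → z≤n
least P? mono {suc k} Pk with P? k
... | yes Pk′ = least P? mono Pk′
... | no ¬Pk′ = suc k , Pk , λ Pj → ≰⇒> (λ j≤k → ¬Pk′ (mono j≤k Pj))

Linked-∷ʳ⁺ : ∀ {A : Set} {R : A → A → Set} xs {y z} →
  Linked R (xs ∷ʳ y) → R y z → Linked R (xs ∷ʳ y ∷ʳ z)
Linked-∷ʳ⁺ []           _          Ryz = Ryz ∷ [-]
Linked-∷ʳ⁺ (_ ∷ [])     (R ∷ Rxs)  Ryz = R ∷ Linked-∷ʳ⁺ [] Rxs Ryz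
Linked-∷ʳ⁺ (_ ∷ _ ∷ xs) (R ∷ Rxs)  Ryz = R ∷ Linked-∷ʳ⁺ (_ ∷ xs) Rxs Ryz

Unique-∷ʳ⁺ : ∀ {A : Set} {xs : List A} {z} → Unique xs → All (_≢ z) xs → Unique (xs ∷ʳ z)
Unique-∷ʳ⁺ u z∉xs =
  Unique.++⁺ u ([] ∷ []) λ { (v∈xs , here refl) → All.lookup z∉xs v∈xs refl }

edge-sym : (G : Graph) {x y : V G} → Edge G x y → Edge G y x
edge-sym G {x} {y} = subst T (adj-sym G x y)

edge-irrefl : (G : Graph) {x : V G} → ¬ Edge G x x
edge-irrefl G {x} = subst T (adj-irrefl G x)

record Matching (G : Graph) {n : ℕ} (P : Fin n → Bool) : Set where
  field
    left right : ∀ i → T (P i) → V G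
    edge       : ∀ i p → Edge G (left i p) (right i p)
    disjoint   : ∀ {i j p q z} → z ∈ left i p ∷ right i p ∷ [] →
                 z ∈ left j q ∷ right j q ∷ [] → i ≡ j

module _ {G : Graph} {n : ℕ} {P : Fin n → Bool} (M : Matching G P) where
  open Matching M

  matching≤cover : ∀ {S} → IsVertexCover G S → ∣ tabulate P ∣ ≤ length S
  matching≤cover {S} cover =
    ∣tabulate∣≤length P (λ i p → proj₁ (covered i p)) (λ i p → proj₁ (proj₂ (covered i p)))
      λ {i} {j} {p} {q} eq →
        disjoint (proj₂ (proj₂ (covered i p))) (subst (_∈ _) (sym eq) (proj₂ (proj₂ (covered j q))))
    where
    covered : ∀ i p → Σ (V G) λ z → z ∈ S × z ∈ left i p ∷ right i p ∷ []
    covered i p with cover _ _ (edge i p)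
    ... | inj₁ l∈S = left i p  , l∈S , here refl
    ... | inj₂ r∈S = right i p , r∈S , there (here refl)

  ⊆G-matching : ∀ {H} → G ⊆G H → Matching H P
  ⊆G-matching (f , f-inj , f-edge) = record
    { left     = λ i p → f (left i p)
    ; right    = λ i p → f (right i p)
    ; edge     = λ i p → f-edge _ _ (edge i p)
    ; disjoint = λ z∈fe z∈fe′ → preimages-disjoint (∈-map⁻ f z∈fe) (∈-map⁻ f z∈fe′)
    }
    where
    preimages-disjoint : ∀ {i j p q z} →
      Σ (V G) (λ x → x ∈ left i p ∷ right i p ∷ [] × z ≡ f x) →
      Σ (V G) (λ x → x ∈ left j q ∷ right j q ∷ [] × z ≡ f x) → i ≡ j
    preimages-disjoint (x , x∈e , refl) (x′ , x′∈e′ , fx≡fx′) =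
      disjoint x∈e (subst (_∈ _) (sym (f-inj fx≡fx′)) x′∈e′)

record EdgeSurjection (G H : Graph) : Set where
  field
    π    : V G → V H
    lift : ∀ {x y} → Edge H x y →
           Σ (V G) λ u → Σ (V G) λ w → Edge G u w × π u ≡ x × π w ≡ y

pullback-matching : ∀ {G H n} {P : Fin n → Bool} →
  EdgeSurjection G H → Matching H P → Matching G P
pullback-matching {G} σ M = record
  { left     = λ i p → proj₁ (lifted i p)
  ; right    = λ i p → proj₁ (proj₂ (lifted i p))
  ; edge     = λ i p → proj₁ (proj₂ (proj₂ (lifted i p)))
  ; disjoint = λ z∈e z∈e′ → disjoint (project z∈e) (project z∈e′)
  }
  where
  open EdgeSurjection σ
  open Matching M
  lifted : ∀ i p → Σ (V G) λ u → Σ (V G) λ w →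
           Edge G u w × π u ≡ left i p × π w ≡ right i p
  lifted i p = lift (edge i p)
  project : ∀ {i p z} → z ∈ proj₁ (lifted i p) ∷ proj₁ (proj₂ (lifted i p)) ∷ [] →
    π z ∈ left i p ∷ right i p ∷ []
  project {i} {p} {z} z∈e with lifted i p
  ... | u , w , _ , πu , πw = subst₂ (λ s t → π z ∈ s ∷ t ∷ []) πu πw (∈-map⁺ π z∈e)

split-surjection : (G : Graph) (v : V G) → EdgeSurjection (Split G v) G
split-surjection G v = record { π = π ; lift = lift }
  where
  π : SplitV G v → V G
  π (inj₁ (x , _)) = x
  π (inj₂ _)       = v
  lift : ∀ {x y} → Edge G x y → Σ (SplitV G v) λ u → Σ (SplitV G v) λ w →
         Edge (Split G v) u w × π u ≡ x × π w ≡ y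
  lift {x} {y} x~y with _≟_ G x v | _≟_ G y v
  ... | yes refl | yes refl = contradiction x~y (edge-irrefl G)
  ... | yes refl | no y≢v   =
    inj₂ (y , x~y) , inj₁ (y , fromWitnessFalse y≢v) , fromWitness refl , refl , refl
  ... | no x≢v   | yes refl =
    inj₁ (x , fromWitnessFalse x≢v) , inj₂ (x , edge-sym G x~y) , fromWitness refl , refl , refl
  ... | no x≢v   | no y≢v   =
    inj₁ (x , fromWitnessFalse x≢v) , inj₁ (y , fromWitnessFalse y≢v) , x~y , refl , refl

InH-matching : ∀ {T₀ G o n} {P : Fin n → Bool} → InH T₀ G o → Matching T₀ P → Matching G P
InH-matching base         M = M
InH-matching (step h v _) M = pullback-matching (split-surjection _ v) (InH-matching h M)

clique-cover : ∀ p m → IsVertexCover (KjoinKc p m) (map inj₁ (allFin p))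
clique-cover p m (inj₁ i) _        _ = inj₁ (∈-map⁺ inj₁ (∈-allFin i))
clique-cover p m (inj₂ _) (inj₁ j) _ = inj₂ (∈-map⁺ inj₁ (∈-allFin j))

length-clique : ∀ p m → length (map (inj₁ {B = Fin m}) (allFin p)) ≡ p
length-clique p m = trans (length-map inj₁ (allFin p)) (length-tabulate (λ i → i))

matching⇒⊈KjoinKc : ∀ {G n} {P : Fin n → Bool} → 1 ≤ ∣ tabulate P ∣ → Matching G P →
  ∀ m → ¬ (G ⊆G KjoinKc (∣ tabulate P ∣ ∸ 1) m)
matching⇒⊈KjoinKc {P = P} 1≤∣P∣ M m G⊆K =
  n≰n∸1 1≤∣P∣ (subst (∣ tabulate P ∣ ≤_) (length-clique p m) bound)
  where
  p : ℕ
  p = ∣ tabulate P ∣ ∸ 1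
  bound : ∣ tabulate P ∣ ≤ length (map (inj₁ {B = Fin m}) (allFin p))
  bound = matching≤cover (⊆G-matching M {KjoinKc p m} G⊆K) (clique-cover p m)
  n≰n∸1 : ∀ {k} → 1 ≤ k → k ≰ k ∸ 1
  n≰n∸1 {suc k} _ = <-irrefl refl

module Depth {n : ℕ} (a : Fin n → Fin n → Bool)
  (a-sym : ∀ x y → a x y ≡ a y x) (a-irr : ∀ x → a x x ≡ false)
  (r : Fin n) (reach : ∀ y → Star (Edge (finGraph n a a-sym a-irr)) r y) where

  G : Graph
  G = finGraph n a a-sym a-irr

  _~_ : Fin n → Fin n → Set
  _~_ = Edge G

  Within : ℕ → Fin n → Set
  Within zero    y = y ≡ r
  Within (suc k) y = Within k y ⊎ ∃[ z ] Within k z × z ~ y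

  within? : ∀ k → Decidable (Within k)
  within? zero    y = y FinP.≟ r
  within? (suc k) y = within? k y ⊎-dec FinP.any? (λ z → within? k z ×-dec T? (a z y))

  within-mono : ∀ {j k y} → j ≤ k → Within j y → Within k y
  within-mono = go ∘ ≤⇒≤′
    where
    go : ∀ {j k y} → j ≤′ k → Within j y → Within k y
    go ≤′-refl w = w
    go (≤′-step j≤k) w = inj₁ (go j≤k w)

  walk⇒within : ∀ {j x y} → Star _~_ x y → Within j x → ∃[ k ] Within k y
  walk⇒within ε       w = _ , w
  walk⇒within (e ◅ s) w = walk⇒within s (inj₂ (_ , w , e))

  shortest : ∀ y → ∃[ d ] Within d y × (∀ {j} → Within j y → d ≤ j)
  shortest y = least (λ k → within? k y) within-mono (proj₂ (walk⇒within {0} (reach y) refl))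

  depth : Fin n → ℕ
  depth y = proj₁ (shortest y)

  depth-within : ∀ y → Within (depth y) y
  depth-within y = proj₁ (proj₂ (shortest y))

  depth-least : ∀ {j y} → Within j y → depth y ≤ j
  depth-least {y = y} = proj₂ (proj₂ (shortest y))

  depth-adjacent : ∀ {x y} → x ~ y → depth y ≤ suc (depth x)
  depth-adjacent {x} x~y = depth-least (inj₂ (x , depth-within x , x~y))

  depth≡0⇒root : ∀ {y} → depth y ≡ 0 → y ≡ r
  depth≡0⇒root {y} dy = subst (λ d → Within d y) dy (depth-within y)

  parent : ∀ {y k} → depth y ≡ suc k → ∃[ z ] z ~ y × depth z ≡ k
  parent {y} {k} dy with subst (λ d → Within d y) dy (depth-within y)
  ... | inj₁ w = contradiction (s≤s (depth-least w)) (<-irrefl dy)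
  ... | inj₂ (z , w , z~y) = z , z~y , ≤-antisym (depth-least w) (≮⇒≥ z-too-close)
    where
    z-too-close : ¬ depth z < k
    z-too-close dz<k = <-irrefl dy (s≤s (≤-trans (depth-adjacent z~y) dz<k))

  ~-sym : ∀ {x y} → x ~ y → y ~ x
  ~-sym = edge-sym G

  module _ (c : Fin n → Bool) (proper : ∀ x y → x ~ y → c x ≢ c y) where

    colour-depth : ∀ k {y} → depth y ≡ k → c y ≡ fold (c r) not k
    colour-depth zero    dy = cong c (depth≡0⇒root dy)
    colour-depth (suc k) dy with parent dy
    ... | z , z~y , dz = trans (¬-not (proper z _ z~y ∘ sym)) (cong not (colour-depth k dz))

    adjacent-depth : ∀ {x y} → x ~ y → depth y ≡ suc (depth x) ⊎ depth x ≡ suc (depth y)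
    adjacent-depth {x} {y} x~y with <-cmp (depth x) (depth y)
    ... | tri< x<y _ _ = inj₁ (≤-antisym (depth-adjacent x~y) x<y)
    ... | tri≈ _ x≡y _ =
      contradiction (trans (colour-depth _ refl) (sym (colour-depth _ (sym x≡y)))) (proper x y x~y)
    ... | tri> _ _ y<x = inj₂ (≤-antisym (depth-adjacent (~-sym x~y)) y<x)

  LowPath : ℕ → Fin n → Fin n → Set
  LowPath k p q = ∃[ ms ] let path = p ∷ (ms ∷ʳ q) in
    Unique path × Linked _~_ path × All (λ w → depth w ≤ k) path

  ≢-by-depth : ∀ {x y k} → depth x ≡ suc k → depth y ≤ k → x ≢ y
  ≢-by-depth dx dy refl = <-irrefl dx (s≤s dy)

  ≢-by-depth′ : ∀ {x y k} → depth y ≡ suc k → depth x ≤ k → x ≢ y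
  ≢-by-depth′ dy dx x≡y = ≢-by-depth dy dx (sym x≡y)

  same-depth-path : ∀ k {p q} → depth p ≡ k → depth q ≡ k → p ≢ q → LowPath k p q
  same-depth-path zero dp dq p≢q =
    contradiction (trans (depth≡0⇒root dp) (sym (depth≡0⇒root dq))) p≢q
  same-depth-path (suc k) {p} {q} dp dq p≢q with parent dp | parent dq
  ... | p′ , p′~p , dp′ | q′ , q′~q , dq′ with p′ FinP.≟ q′
  ... | yes refl =
      (p′ ∷ [])
    , ((≢-by-depth dp dp′≤k ∷ p≢q ∷ []) ∷ (≢-by-depth′ dq dp′≤k ∷ []) ∷ [] ∷ [])
    , (~-sym p′~p ∷ q′~q ∷ [-])
    , (≤-reflexive dp ∷ m≤n⇒m≤1+n dp′≤k ∷ ≤-reflexive dq ∷ [])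
    where
    dp′≤k : depth p′ ≤ k
    dp′≤k = ≤-reflexive dp′
  ... | no p′≢q′ with same-depth-path k dp′ dq′ p′≢q′
  ... | ms , unique , linked , low =
      (p′ ∷ (ms ∷ʳ q′))
    , (AllP.∷ʳ⁺ (All.map (≢-by-depth dp) low) p≢q
        ∷ Unique-∷ʳ⁺ unique (All.map (≢-by-depth′ dq) low))
    , (~-sym p′~p ∷ Linked-∷ʳ⁺ (p′ ∷ ms) linked q′~q)
    , (≤-reflexive dp ∷ AllP.∷ʳ⁺ (All.map m≤n⇒m≤1+n low) (≤-reflexive dq))

  -- two parents x, x′ of y would close the cycle y, x, …, x′
  unique-parent : Acyclic G → ∀ {x x′ y} → x ~ y → x′ ~ y →
    depth y ≡ suc (depth x) → depth y ≡ suc (depth x′) → x ≡ x′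
  unique-parent acyclic {x} {x′} {y} x~y x′~y dy dy′ with x FinP.≟ x′
  ... | yes x≡x′ = x≡x′
  ... | no x≢x′ with same-depth-path (depth x) refl (suc-injective (trans (sym dy′) dy)) x≢x′
  ... | ms , unique , linked , low = contradiction cycle (acyclic y (x ∷ (ms ∷ʳ x′)))
    where
    cycle : IsCycle G y (x ∷ (ms ∷ʳ x′))
    cycle = s≤s (subst (1 ≤_) (sym (length-++ ms)) (m≤n+m 1 (length ms)))
          , (All.map (≢-by-depth dy) low ∷ unique)
          , (~-sym x~y ∷ Linked-∷ʳ⁺ (x ∷ ms) linked x′~y)

  child : Acyclic G → (c : Fin n → Bool) → (∀ x y → x ~ y → c x ≢ c y) →
    ∀ x → 2 ≤ degree a x → ∃[ y ] x ~ y × depth y ≡ suc (depth x)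
  child acyclic c proper x deg with FinP.any? (λ y → T? (a x y) ×-dec (depth y ℕ.≟ suc (depth x)))
  ... | yes found = found
  ... | no none   = contradiction (≤-trans deg degree≤1) (<-irrefl refl)
    where
    to-parent : ∀ {y} → x ~ y → depth x ≡ suc (depth y)
    to-parent {y} x~y with adjacent-depth c proper x~y
    ... | inj₁ dy = contradiction (y , x~y , dy) none
    ... | inj₂ dx = dx
    -- every neighbour of x is its unique parent
    degree≤1 : degree a x ≤ 1
    degree≤1 = ∣tabulate∣≤length (a x) {xs = tt ∷ []} (λ _ _ → tt) (λ _ _ → here refl)
      λ {_} {_} {x~y} {x~y′} _ →
        unique-parent acyclic (~-sym x~y) (~-sym x~y′) (to-parent x~y) (to-parent x~y′)

tree-matching : ∀ {n} (a : Fin n → Fin n → Bool)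
  (a-sym : ∀ x y → a x y ≡ a y x) (a-irr : ∀ x → a x x ≡ false) →
  IsTree (finGraph n a a-sym a-irr) →
  (c : Fin n → Bool) → (∀ x y → T (a x y) → c x ≢ c y) → Fin n →
  (∀ x → c x ≡ false → 2 ≤ degree a x) → Matching (finGraph n a a-sym a-irr) (not ∘ c)
tree-matching a a-sym a-irr (connected , acyclic) c proper r deg = record
  { left     = λ x _ → x
  ; right    = λ x p → proj₁ (kid x p)
  ; edge     = λ x p → proj₁ (proj₂ (kid x p))
  ; disjoint = disjoint
  }
  where
  open Depth a a-sym a-irr r (connected r)

  inA : ∀ {x} → T (not (c x)) → c x ≡ false
  inA = Equivalence.to T-not-≡

  kid : ∀ x → T (not (c x)) → ∃[ y ] x ~ y × depth y ≡ suc (depth x)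
  kid x p = child acyclic c proper x (deg x (inA p))

  kid∉A : ∀ {x y} p q → y ≢ proj₁ (kid x p)
  kid∉A {x} {y} p q y≡kid = contradiction (trans (sym (inA q)) colour-kid) λ ()
    where
    colour-kid : c y ≡ true
    colour-kid = trans (cong c y≡kid)
      (trans (¬-not (proper x _ (proj₁ (proj₂ (kid x p))) ∘ sym)) (cong not (inA p)))

  disjoint : ∀ {x x′ p q z} → z ∈ x ∷ proj₁ (kid x p) ∷ [] →
    z ∈ x′ ∷ proj₁ (kid x′ q) ∷ [] → x ≡ x′
  disjoint                 (here refl)         (here refl)           = refl
  disjoint {p = p} {q = q} (here refl)         (there (here x≡kid′)) = contradiction x≡kid′ (kid∉A q p)
  disjoint {p = p} {q = q} (there (here refl)) (here refl)           = contradiction refl (kid∉A p q)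
  disjoint {x} {x′} {p} {q} (there (here refl)) (there (here kid≡kid′)) =
    unique-parent acyclic (proj₁ (proj₂ (kid x p)))
      (subst (x′ ~_) (sym kid≡kid′) (proj₁ (proj₂ (kid x′ q))))
      (proj₂ (proj₂ (kid x p)))
      (trans (cong depth kid≡kid′) (proj₂ (proj₂ (kid x′ q))))

colour-class-cover : ∀ {n} (a : Fin n → Fin n → Bool)
  (a-sym : ∀ x y → a x y ≡ a y x) (a-irr : ∀ x → a x x ≡ false) →
  (c : Fin n → Bool) → (∀ x y → T (a x y) → c x ≢ c y) →
  IsVertexCover (finGraph n a a-sym a-irr) (filter (T? ∘ (not ∘ c)) (allFin n))
colour-class-cover a a-sym a-irr c proper x y x~y with c x in cx
... | false = inj₁ (∈-filter⁺ (T? ∘ (not ∘ c)) (∈-allFin x) (Equivalence.from T-not-≡ cx))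
... | true  = inj₂ (∈-filter⁺ (T? ∘ (not ∘ c)) (∈-allFin y)
                (Equivalence.from T-not-≡ (trans (¬-not (proper x y x~y ∘ sym)) (cong not cx))))

lemma2p7 : (n : ℕ) (a : Fin n → Fin n → Bool)
  (a-sym : ∀ x y → a x y ≡ a y x) (a-irr : ∀ x → a x x ≡ false) →
  IsTree (finGraph n a a-sym a-irr) →
  (c : Fin n → Bool) →
  (∀ x y → T (a x y) → c x ≢ c y) →
  ∣ tabulate (not ∘ c) ∣ ≤ ∣ tabulate c ∣ →
  Σ (Fin n) (λ x → c x ≡ false) →
  (∀ x → c x ≡ false → 2 ≤ degree a x) →
  IsVertexCoverNumber (finGraph n a a-sym a-irr) ∣ tabulate (not ∘ c) ∣
  × (∀ G → G ∈H finGraph n a a-sym a-irr → ∀ k → IsVertexCoverNumber G k →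
       ∣ tabulate (not ∘ c) ∣ ≤ k)
  × (∀ m → 1 ≤ m → ∀ G → G ∈H finGraph n a a-sym a-irr →
       ¬ (G ⊆G KjoinKc (∣ tabulate (not ∘ c) ∣ ∸ 1) m))
lemma2p7 n a a-sym a-irr tree c proper _ (r , r∈A) deg =
    ( ( filter (T? ∘ (not ∘ c)) (allFin n) , Unique.filter⁺ (T? ∘ (not ∘ c)) (Unique.allFin⁺ n)
      , colour-class-cover a a-sym a-irr c proper , length-filter-tabulate (not ∘ c) (λ x → x))
    , λ S _ → matching≤cover M)
  , (λ { G (_ , h) k ((S , _ , S-covers , refl) , _) → matching≤cover (InH-matching h M) S-covers })
  , λ { m _ G (_ , h) →
        matching⇒⊈KjoinKc (1≤∣tabulate∣ (not ∘ c) r (cong not r∈A)) (InH-matching h M) m }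
  where
  M : Matching (finGraph n a a-sym a-irr) (not ∘ c)
  M = tree-matching a a-sym a-irr tree c proper r deg
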